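{- For every integer $n\ge1$, let $\mathcal{S}^{\mathtt{p}}_n$ be the set of length-$n$ prefixes of all infinite strings $T$ over $\{\mathtt{a},\mathtt{b}\}$ such that the first $\mathtt{b}$ of $T$ is at $T[1]$ and, for each $j\ge2$, the $j$th $\mathtt{b}$ of $T$ lies somewhere in $T[2\cdot4^{j-2}+1\mathinner{.\,.} 4^{j-1}]$. Then encoding the members of $\mathcal{S}^{\mathtt{p}}_n$ requires $\Omega(\log^2 n)$ bits, i.e., $\log_2|\mathcal{S}^{\mathtt{p}}_n|=\Omega(\log^2 n)$.
   Context: Logarithms are base 2. The $\Omega$ hides a universal constant (asymptotically in $n$). -}

module Defs where

open import Data.Nat using (ℕ; zero; suc; _+_; _*_; _∸_; _^_; _≤_)
open import Data.Bool using (Bool; true; false)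
open import Data.Fin using (Fin; toℕ)
open import Data.Vec using (Vec; lookup)
open import Data.Product using (Σ; _×_; ∃-syntax)
open import Relation.Binary.PropositionalEquality using (_≡_)

-- An infinite string over {a,b}: T : ℕ → Bool, stored 0-based,
-- with  true = b  and  false = a.  The paper's (1-based) letter T[i]
-- is  T (i ∸ 1)  for i ≥ 1.
InfString : Set
InfString = ℕ → Bool

-- number of b's among the paper's T[1 .. i]  (i.e. T 0, …, T (i ∸ 1))
countB : InfString → ℕ → ℕ
countB T zero = zero
countB T (suc i) with T i
... | true  = suc (countB T i)
... | false = countB T i

JthBAt : InfString → ℕ → ℕ → Set
JthBAt T j i = (1 ≤ i) × (T (i ∸ 1) ≡ true) × (countB T i ≡ j)

GoodT : InfString → Set
GoodT T = JthBAt T 1 1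
        × (∀ j → 2 ≤ j →
             ∃[ i ] ((2 * 4 ^ (j ∸ 2) + 1 ≤ i) × (i ≤ 4 ^ (j ∸ 1)) × JthBAt T j i))

IsPrefix : ∀ {n} → Vec Bool n → InfString → Set
IsPrefix {n} w T = ∀ (k : Fin n) → lookup w k ≡ T (toℕ k)

InSp : (n : ℕ) → Vec Bool n → Set
InSp n w = ∃[ T ] (GoodT T × IsPrefix w T)

module Submission where

-- Write the prefix length as 4^m ≤ n < 4^(m+1). Number the blocks
-- t = 0, 1, … and let block t be the 0-based window [2·4^t, 4^(t+1)) of length
-- 2·4^t; it is the paper's window for the (t+2)-th b. Any choice of offsets
-- c t < 2·4^t gives a member of S^p: put b's at 0 and at 2·4^t + c t, a's elsewhere.
-- The windows are disjoint, so the length-n prefix determines the offsets of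
-- the m blocks lying inside it. Reading the offsets of blocks t < m as the digits
-- of a mixed-radix numeral with radices 2·4^t yields
-- ∏_{t<m} 2·4^t = 2^(m²) distinct prefixes, and ⌊log₂ n⌋ ≤ 2m + 2 ≤ 4m.

open import Defs
open import Data.Nat using (ℕ; _^_; _*_; _≤_)
open import Data.Nat.Logarithm using (⌊log₂_⌋)
open import Data.Bool using (Bool)
open import Data.Fin using (Fin)
open import Data.Vec using (Vec)
open import Data.Product using (Σ; _×_; ∃-syntax)
open import Function.Definitions using (Injective)
open import Relation.Binary.PropositionalEquality using (_≡_)

open import Data.Nat using (zero; suc; _+_; _∸_; _<_; z≤n; s≤s; _≟_; _<?_)
open import Data.Nat.Properties
open import Data.Nat.Logarithm using (⌊log₂⌋-mono-≤; ⌊log₂[2^n]⌋≡n)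
open import Data.Nat.Tactic.RingSolver using (solve-∀)
open import Data.Bool using (true; false)
open import Data.Fin using (toℕ; fromℕ<; quotient; remainder; combine)
open import Data.Fin.Patterns using (0F)
open import Data.Fin.Properties using (toℕ<n; toℕ-injective; toℕ-fromℕ<; combine-remQuot)
open import Data.Vec using (lookup; tabulate)
open import Data.Vec.Properties using (lookup∘tabulate)
open import Data.Product using (_,_)
open import Data.Sum using (inj₁; inj₂)
open import Data.Empty using (⊥; ⊥-elim)
open import Function using (_∘_)
open import Relation.Nullary using (yes; no; does)
open import Relation.Nullary.Decidable using (dec-true; dec-false)
open import Relation.Binary.PropositionalEquality using (_≢_; refl; sym; trans; cong; cong₂; subst; module ≡-Reasoning)

countB-b : ∀ T p → T p ≡ true → countB T (suc p) ≡ suc (countB T p)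
countB-b T p e with T p
countB-b T p refl | true = refl

countB-a : ∀ T p → T p ≡ false → countB T (suc p) ≡ countB T p
countB-a T p e with T p
countB-a T p refl | false = refl

countB-flat : ∀ T {a b} → a ≤ b → (∀ {p} → a ≤ p → p < b → T p ≡ false) →
              countB T b ≡ countB T a
countB-flat T {b = zero} z≤n only-a = refl
countB-flat T {a} {suc b} a≤1+b only-a with m≤n⇒m<n∨m≡n a≤1+b
... | inj₂ refl = refl
... | inj₁ (s≤s a≤b) =
  trans (countB-a T b (only-a a≤b ≤-refl))
        (countB-flat T a≤b (λ lo hi → only-a lo (m≤n⇒m≤1+n hi)))

module Marks (Q : ℕ → ℕ) (Q-step : ∀ s → Q s < Q (suc s)) where

  open ≡-Reasoning

  Q-mono : ∀ {s s'} → s ≤ s' → Q s ≤ Q s'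
  Q-mono {s' = zero} z≤n = ≤-refl
  Q-mono {s} {suc s'} s≤1+s' with m≤n⇒m<n∨m≡n s≤1+s'
  ... | inj₂ refl = ≤-refl
  ... | inj₁ (s≤s s≤s') = ≤-trans (Q-mono s≤s') (<⇒≤ (Q-step s'))

  Q-reflects-< : ∀ {s s'} → Q s < Q s' → s < s'
  Q-reflects-< Qs<Qs' = ≰⇒> (λ s'≤s → <⇒≱ Qs<Qs' (Q-mono s'≤s))

  s≤Q : ∀ s → s ≤ Q s
  s≤Q zero = z≤n
  s≤Q (suc s) = ≤-trans (s≤s (s≤Q s)) (Q-step s)

  -- p carries a b iff p = Q s for some s; as s ≤ Q s, searching s ≤ p suffices.
  marks : InfString
  marks p = does (anyUpTo? (λ s → Q s ≟ p) (suc p))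

  marks-Q : ∀ s → marks (Q s) ≡ true
  marks-Q s = dec-true (anyUpTo? (λ s' → Q s' ≟ Q s) (suc (Q s))) (s , s≤s (s≤Q s) , refl)

  marks⇒Q : ∀ {p} → marks p ≡ true → ∃[ s ] (Q s ≡ p)
  marks⇒Q {p} b with anyUpTo? (λ s → Q s ≟ p) (suc p)
  ... | yes (s , _ , Qs≡p) = s , Qs≡p
  marks⇒Q () | no _

  unmarked : ∀ {p} → (∀ s → Q s ≢ p) → marks p ≡ false
  unmarked {p} none = dec-false (anyUpTo? (λ s → Q s ≟ p) (suc p)) (λ (s , _ , e) → none s e)

  nothing-before : ∀ {p} → p < Q 0 → ∀ s → Q s ≢ p
  nothing-before p<Q0 s refl = <⇒≱ p<Q0 (Q-mono z≤n)

  nothing-between : ∀ s {p} → Q s < p → p < Q (suc s) → ∀ s' → Q s' ≢ p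
  nothing-between s lo hi s' refl =
    <⇒≱ (Q-reflects-< lo) (≤-pred (Q-reflects-< hi))

  countB-Q : ∀ s → countB marks (suc (Q s)) ≡ suc s
  countB-Q zero = begin
    countB marks (suc (Q 0))  ≡⟨ countB-b marks (Q 0) (marks-Q 0) ⟩
    suc (countB marks (Q 0))  ≡⟨ cong suc (countB-flat marks z≤n
                                   (λ _ p<Q0 → unmarked (nothing-before p<Q0))) ⟩
    1                          ∎
  countB-Q (suc s) = begin
    countB marks (suc (Q (suc s)))  ≡⟨ countB-b marks (Q (suc s)) (marks-Q (suc s)) ⟩
    suc (countB marks (Q (suc s)))  ≡⟨ cong suc (countB-flat marks (Q-step s)
                                         (λ lo hi → unmarked (nothing-between s lo hi))) ⟩
    suc (countB marks (suc (Q s)))  ≡⟨ cong suc (countB-Q s) ⟩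
    suc (suc s)                      ∎

  jth-b : ∀ s → JthBAt marks (suc s) (suc (Q s))
  jth-b s = s≤s z≤n , marks-Q s , countB-Q s

-- Length of block t, i.e. of the 0-based window [2·4^t, 4^(t+1)).
blockLength : ℕ → ℕ
blockLength t = 2 * 4 ^ t

window-before : ∀ {s u x} → s < u → x < 4 ^ suc s → blockLength u ≤ x → ⊥
window-before {s} {u} {x} s<u x<end start≤x = <-irrefl refl (begin-strict
  x             <⟨ x<end ⟩
  4 ^ suc s     ≤⟨ ^-monoʳ-≤ 4 s<u ⟩
  4 ^ u         ≤⟨ m≤m+n (4 ^ u) _ ⟩
  blockLength u ≤⟨ start≤x ⟩
  x             ∎)
  where open ≤-Reasoning

window-unique : ∀ {t t' x} → blockLength t ≤ x → x < 4 ^ suc t →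
                blockLength t' ≤ x → x < 4 ^ suc t' → t ≡ t'
window-unique lo hi lo' hi' =
  ≤-antisym (≮⇒≥ (λ t'<t → window-before t'<t hi' lo))
            (≮⇒≥ (λ t<t' → window-before t<t' hi lo'))

-- Offsets c t < blockLength t put the (t+2)-th b at 0-based position 2·4^t + c t.
module Blocks (c : ℕ → ℕ) (c<length : ∀ t → c t < blockLength t) where

  -- 0-based position of the (t+1)-th b.
  bPos : ℕ → ℕ
  bPos zero = 0
  bPos (suc t) = blockLength t + c t

  bPos-low : ∀ t → blockLength t ≤ bPos (suc t)
  bPos-low t = m≤m+n (blockLength t) (c t)

  bPos-high : ∀ t → bPos (suc t) < 4 ^ suc t
  bPos-high t = subst (bPos (suc t) <_) (sym (*-distribʳ-+ (4 ^ t) 2 2))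
                      (+-monoʳ-< (blockLength t) (c<length t))

  bPos-step : ∀ t → bPos t < bPos (suc t)
  bPos-step zero = s≤s z≤n
  bPos-step (suc t) = <-≤-trans (bPos-high t)
                        (≤-trans (m≤m+n (4 ^ suc t) _) (bPos-low (suc t)))

  open Marks bPos bPos-step public using (marks; marks-Q; marks⇒Q; jth-b)

  -- In the paper's 1-based terms, the (t+2)-th b is at 2·4^t + c t + 1 ∈ [2·4^t + 1, 4^(t+1)].
  good : GoodT marks
  good = jth-b 0 , later
    where
    later : ∀ j → 2 ≤ j → ∃[ i ] ((2 * 4 ^ (j ∸ 2) + 1 ≤ i) × (i ≤ 4 ^ (j ∸ 1)) × JthBAt marks j i)
    later (suc zero) (s≤s ())
    later (suc (suc t)) _ =
      suc (bPos (suc t)) ,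
      ≤-trans (≤-reflexive (+-comm (blockLength t) 1)) (s≤s (bPos-low t)) ,
      bPos-high t ,
      jth-b (suc t)

offset-recovered : ∀ c c<length c' c'<length t →
  Blocks.marks c' c'<length (Blocks.bPos c c<length (suc t)) ≡ true → c' t ≡ c t
offset-recovered c c<length c' c'<length t b = recover (B'.marks⇒Q b)
  where
  module B = Blocks c c<length
  module B' = Blocks c' c'<length
  recover : ∃[ s ] (B'.bPos s ≡ B.bPos (suc t)) → c' t ≡ c t
  recover (zero , 0≡x) =
    ⊥-elim (<-irrefl 0≡x (<-≤-trans (m^n>0 4 t) (≤-trans (m≤m+n (4 ^ t) _) (B.bPos-low t))))
  recover (suc t' , x'≡x) with window-unique {t'} {t}
                                (subst (blockLength t' ≤_) x'≡x (B'.bPos-low t'))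
                                (subst (_< 4 ^ suc t') x'≡x (B'.bPos-high t'))
                                (B.bPos-low t) (B.bPos-high t)
  ... | refl = +-cancelˡ-≡ (blockLength t) (c' t) (c t) x'≡x

-- (4) Mixed-radix numerals with radices r 0, r 1, …: Fin (Radix r m) is read
-- as the digit sequence of its element, digit t < r t, and digits t ≥ m are 0.

Radix : (ℕ → ℕ) → ℕ → ℕ
Radix r zero = 1
Radix r (suc m) = Radix r m * r m

setAt : ℕ → ℕ → (ℕ → ℕ) → ℕ → ℕ
setAt m b d t with t ≟ m
... | yes _ = b
... | no _ = d t

setAt-here : ∀ m b d → setAt m b d m ≡ b
setAt-here m b d with m ≟ m
... | yes _ = refl
... | no m≢m = ⊥-elim (m≢m refl)

setAt-elsewhere : ∀ {m t} b d → t < m → setAt m b d t ≡ d t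
setAt-elsewhere {m} {t} b d t<m with t ≟ m
... | yes refl = ⊥-elim (<-irrefl refl t<m)
... | no _ = refl

module MixedRadix (r : ℕ → ℕ) (r-pos : ∀ t → 0 < r t) where

  lower : ∀ m → Fin (Radix r (suc m)) → Fin (Radix r m)
  lower m = quotient {Radix r m} (r m)

  top : ∀ m → Fin (Radix r (suc m)) → Fin (r m)
  top m = remainder {Radix r m} (r m)

  lower-top : ∀ m i → combine (lower m i) (top m i) ≡ i
  lower-top m = combine-remQuot {Radix r m} (r m)

  -- digit m i t is the t-th digit of i (the top digit is the remainder, as in combine).
  digit : ∀ m → Fin (Radix r m) → ℕ → ℕ
  digit zero _ _ = 0
  digit (suc m) i = setAt m (toℕ (top m i)) (digit m (lower m i))

  digit-bound : ∀ m i t → digit m i t < r t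
  digit-bound zero _ t = r-pos t
  digit-bound (suc m) i t with t ≟ m
  ... | yes refl = toℕ<n (top m i)
  ... | no _ = digit-bound m (lower m i) t

  digit-injective : ∀ m {i i'} → (∀ {t} → t < m → digit m i t ≡ digit m i' t) → i ≡ i'
  digit-injective zero {0F} {0F} _ = refl
  digit-injective (suc m) {i} {i'} same = begin
    i                                ≡⟨ sym (lower-top m i) ⟩
    combine (lower m i) (top m i)    ≡⟨ cong₂ combine same-lower same-top ⟩
    combine (lower m i') (top m i')  ≡⟨ lower-top m i' ⟩
    i'                               ∎
    where
    open ≡-Reasoning
    same-lower : lower m i ≡ lower m i'
    same-lower = digit-injective m λ {t} t<m → begin
      digit m (lower m i) t   ≡⟨ sym (setAt-elsewhere _ _ t<m) ⟩
      digit (suc m) i t       ≡⟨ same (m≤n⇒m≤1+n t<m) ⟩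
      digit (suc m) i' t      ≡⟨ setAt-elsewhere _ _ t<m ⟩
      digit m (lower m i') t  ∎
    same-top : top m i ≡ top m i'
    same-top = toℕ-injective (begin
      toℕ (top m i)       ≡⟨ sym (setAt-here m _ _) ⟩
      digit (suc m) i m   ≡⟨ same ≤-refl ⟩
      digit (suc m) i' m  ≡⟨ setAt-here m _ _ ⟩
      toℕ (top m i')      ∎)

-- ∏_{t<m} 2·4^t = 2^(m²), since m² + (2m + 1) = (m + 1)².
Radix-blockLength : ∀ m → Radix blockLength m ≡ 2 ^ (m * m)
Radix-blockLength zero = refl
Radix-blockLength (suc m) = begin
  Radix blockLength m * (2 * 4 ^ m)   ≡⟨ cong₂ (λ x y → x * (2 * y)) (Radix-blockLength m) (^-*-assoc 2 2 m) ⟩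
  2 ^ (m * m) * 2 ^ suc (2 * m)       ≡⟨ sym (^-distribˡ-+-* 2 (m * m) (suc (2 * m))) ⟩
  2 ^ (m * m + suc (2 * m))           ≡⟨ cong (2 ^_) (square-suc m) ⟩
  2 ^ (suc m * suc m)                 ∎
  where
  open ≡-Reasoning
  square-suc : ∀ m → m * m + suc (2 * m) ≡ suc m * suc m
  square-suc = solve-∀

power-bracket : ∀ b → 1 < b → ∀ n → 1 ≤ n → ∃[ m ] (b ^ m ≤ n × n < b ^ suc m)
power-bracket b 1<b (suc zero) _ = 0 , ≤-refl , ^-monoʳ-< b 1<b (n<1+n 0)
power-bracket b 1<b (suc (suc n)) _ with power-bracket b 1<b (suc n) (s≤s z≤n)
... | m , lo , hi with suc (suc n) <? b ^ suc m
...   | yes below = m , m≤n⇒m≤1+n lo , below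
...   | no not-below = suc m , ≤-reflexive power≡ ,
                       subst (_< b ^ suc (suc m)) power≡ (^-monoʳ-< b 1<b (n<1+n (suc m)))
  where
  power≡ : b ^ suc m ≡ suc (suc n)
  power≡ = ≤-antisym (≮⇒≥ not-below) hi

-- For m ≥ 1 and n < 4^(m+1): ⌊log₂ n⌋ ≤ 2m + 2 ≤ 4m, so ⌊log₂ n⌋² ≤ 16 m².
log²-bound : ∀ {n m} → 1 ≤ m → n < 4 ^ suc m → ⌊log₂ n ⌋ * ⌊log₂ n ⌋ ≤ (m * m) * 16
log²-bound {n} {m} 1≤m n<4^[1+m] =
  ≤-trans (*-mono-≤ log≤4m log≤4m) (≤-reflexive (square-4* m))
  where
  open ≤-Reasoning
  square-4* : ∀ m → (4 * m) * (4 * m) ≡ (m * m) * 16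
  square-4* = solve-∀
  twice-double : ∀ m → 2 * (m + m) ≡ 4 * m
  twice-double = solve-∀
  log≤4m : ⌊log₂ n ⌋ ≤ 4 * m
  log≤4m = begin
    ⌊log₂ n ⌋                  ≤⟨ ⌊log₂⌋-mono-≤ (<⇒≤ n<4^[1+m]) ⟩
    ⌊log₂ (4 ^ suc m) ⌋        ≡⟨ cong ⌊log₂_⌋ (^-*-assoc 2 2 (suc m)) ⟩
    ⌊log₂ (2 ^ (2 * suc m)) ⌋  ≡⟨ ⌊log₂[2^n]⌋≡n (2 * suc m) ⟩
    2 * suc m                  ≤⟨ *-monoʳ-≤ 2 (≤-trans (≤-reflexive (+-comm 1 m)) (+-monoʳ-≤ m 1≤m)) ⟩
    2 * (m + m)                ≡⟨ twice-double m ⟩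
    4 * m                      ∎

enough-codes : ∀ {n m} → 1 ≤ m → n < 4 ^ suc m →
               2 ^ (⌊log₂ n ⌋ * ⌊log₂ n ⌋) ≤ Radix blockLength m ^ 16
enough-codes {n} {m} 1≤m n<4^[1+m] = begin
  2 ^ (⌊log₂ n ⌋ * ⌊log₂ n ⌋)  ≤⟨ ^-monoʳ-≤ 2 (log²-bound 1≤m n<4^[1+m]) ⟩
  2 ^ ((m * m) * 16)           ≡⟨ sym (^-*-assoc 2 (m * m) 16) ⟩
  (2 ^ (m * m)) ^ 16           ≡⟨ cong (_^ 16) (sym (Radix-blockLength m)) ⟩
  Radix blockLength m ^ 16     ∎
  where open ≤-Reasoning

prefix : ∀ n → InfString → Vec Bool n
prefix n T = tabulate (λ k → T (toℕ k))

prefix-isPrefix : ∀ n T → IsPrefix (prefix n T) T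
prefix-isPrefix n T = lookup∘tabulate (λ k → T (toℕ k))

prefix-agree : ∀ {n} T T' → prefix n T ≡ prefix n T' → ∀ {p} → p < n → T p ≡ T' p
prefix-agree {n} T T' same {p} p<n = begin
  T p                                ≡⟨ cong T (sym (toℕ-fromℕ< p<n)) ⟩
  T (toℕ (fromℕ< p<n))               ≡⟨ sym (lookup∘tabulate _ (fromℕ< p<n)) ⟩
  lookup (prefix n T) (fromℕ< p<n)   ≡⟨ cong (λ w → lookup w (fromℕ< p<n)) same ⟩
  lookup (prefix n T') (fromℕ< p<n)  ≡⟨ lookup∘tabulate _ (fromℕ< p<n) ⟩
  T' (toℕ (fromℕ< p<n))              ≡⟨ cong T' (toℕ-fromℕ< p<n) ⟩
  T' p                               ∎
  where open ≡-Reasoning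

module Coding (m : ℕ) where
  open MixedRadix blockLength (λ t → <-≤-trans (m^n>0 4 t) (m≤m+n (4 ^ t) _))

  string : Fin (Radix blockLength m) → InfString
  string i = Blocks.marks (digit m i) (digit-bound m i)

  string-good : ∀ i → GoodT (string i)
  string-good i = Blocks.good (digit m i) (digit-bound m i)

  -- Blocks t < m lie inside any prefix of length n ≥ 4^m, so the prefix determines i.
  prefix-injective : ∀ {n} → 4 ^ m ≤ n → Injective _≡_ _≡_ (prefix n ∘ string)
  prefix-injective {n} 4^m≤n {i} {i'} same = digit-injective m λ {t} t<m →
    sym (offset-recovered (digit m i) (digit-bound m i) (digit m i') (digit-bound m i') t
      (trans (sym (prefix-agree (string i) (string i') same (inside t<m)))
             (Blocks.marks-Q (digit m i) (digit-bound m i) (suc t))))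
    where
    inside : ∀ {t} → t < m → Blocks.bPos (digit m i) (digit-bound m i) (suc t) < n
    inside {t} t<m = <-≤-trans (Blocks.bPos-high (digit m i) (digit-bound m i) t)
                               (≤-trans (^-monoʳ-≤ 4 t<m) 4^m≤n)

LargeFamily : ℕ → ℕ → Set
LargeFamily k n = ∃[ M ] ((2 ^ (⌊log₂ n ⌋ * ⌊log₂ n ⌋) ≤ M ^ k)
                    × (Σ (Fin M → Vec Bool n) λ f →
                         Injective _≡_ _≡_ f × (∀ i → InSp n (f i))))

large-family : ∀ n → 4 ≤ n → LargeFamily 16 n
large-family n 4≤n with power-bracket 4 (s≤s (s≤s z≤n)) n (≤-trans (s≤s z≤n) 4≤n)
... | zero , _ , n<4 = ⊥-elim (<⇒≱ n<4 4≤n)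
... | suc m , 4^m≤n , n<4^[1+m] =
  Radix blockLength (suc m) ,
  enough-codes {m = suc m} (s≤s z≤n) n<4^[1+m] ,
  prefix n ∘ string ,
  prefix-injective 4^m≤n ,
  λ i → string i , string-good i , prefix-isPrefix n (string i)
  where open Coding (suc m)

lemma5 : ∃[ k ] ∃[ n₀ ] (1 ≤ k × (∀ n → n₀ ≤ n → 1 ≤ n →
    ∃[ M ] ((2 ^ (⌊log₂ n ⌋ * ⌊log₂ n ⌋) ≤ M ^ k)
    × (Σ (Fin M → Vec Bool n) λ f →
    Injective _≡_ _≡_ f × (∀ i → InSp n (f i))))))
lemma5 = 16 , 4 , s≤s z≤n , λ n 4≤n _ → large-family n 4≤n
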